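{- Let $(G,\mathcal{B},\mathcal{L},\mathcal{F})$ be a quasi-biased graph, let $L_{\mathcal{B}}$ be its set of loops that are in $\mathcal{B}$, and let $L_{\mathcal{L}}$ be its set of loops that are in $\mathcal{L}$. Let $U\subseteq V(G)$. If $E(G[U])$ contains no cycle in $\mathcal{L}$, then $E(G[U])\cup L_{\mathcal{B}}$ is a flat of $M(G,\mathcal{B},\mathcal{L},\mathcal{F})$. Otherwise $E(G[U])\cup L_{\mathcal{B}}\cup L_{\mathcal{L}}$ is a flat of $M(G,\mathcal{B},\mathcal{L},\mathcal{F})$.
   Context: Graphs are finite with loops and parallel edges allowed; cycles include loops (a loop is a 1-cycle) and 2-cycles. A quasi-biased graph $(G,\mathcal{B},\mathcal{L},\mathcal{F})$ is a graph with a partition $(\mathcal{B},\mathcal{L},\mathcal{F})$ of its cycles such that no theta subgraph contains exactly two cycles of $\mathcal{B}$ and every cycle in $\mathcal{L}$ shares a vertex with every cycle in $\mathcal{F}$. $M(G,\mathcal{B},\mathcal{L},\mathcal{F})$ is the matroid on $E(G)$ with circuits: cycles in $\mathcal{B}$; theta subgraphs with no cycle in $\mathcal{B}$; tight handcuffs (two edge-disjoint cycles sharing exactly one vertex) with neither cycle in $\mathcal{B}$; unions of two vertex-disjoint cycles of $\mathcal{L}$; loose handcuffs (two vertex-disjoint cycles plus a minimal path joining them) with both cycles in $\mathcal{F}$. $G[U]$ is the subgraph induced by $U$. -}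

module Defs where

open import Data.Nat using (ℕ; zero; suc; _+_)
open import Data.Fin using (Fin)
open import Data.Fin.Subset
  using (Subset; _∈_; _∉_; _⊆_; _∪_; _∩_; _─_; ⁅_⁆; Nonempty; Empty; inside; outside)
open import Data.Vec using (Vec; allFin; map; sum; lookup)
open import Data.Bool using (Bool; true; false; if_then_else_)
open import Data.Product using (Σ; ∃; ∃-syntax; _×_; _,_)
open import Data.Sum using (_⊎_)
open import Relation.Nullary using (¬_; does)
open import Relation.Binary.PropositionalEquality using (_≡_; _≢_)
import Data.Fin as F

-- Finite graphs with loops and parallel edges allowed.
-- Vertices are Fin n, edges are Fin m; each edge e has two ends
-- end₁ e and end₂ e (a loop has end₁ e ≡ end₂ e).

record Graph : Set where
  field
    n    : ℕ
    m    : ℕ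
    end₁ : Fin m → Fin n
    end₂ : Fin m → Fin n

module _ (G : Graph) where
  open Graph G

  -- edge sets of G (subgraphs are identified with their edge sets)
  ESet : Set
  ESet = Subset m

  VSet : Set
  VSet = Subset n

  isLoop : Fin m → Set
  isLoop e = end₁ e ≡ end₂ e

  Incident : Fin m → Fin n → Set
  Incident e v = (end₁ e ≡ v) ⊎ (end₂ e ≡ v)

  endCount : Fin m → Fin n → ℕ
  endCount e v = (if does (end₁ e F.≟ v) then 1 else 0)
               + (if does (end₂ e F.≟ v) then 1 else 0)

  deg : ESet → Fin n → ℕ
  deg S v = sum (map (λ e → if lookup S e then endCount e v else 0) (allFin m))

  VertexOf : ESet → Fin n → Set
  VertexOf S v = ∃[ e ] (e ∈ S × Incident e v)

  Adjacent : Fin m → Fin m → Set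
  Adjacent e f = ∃[ v ] (Incident e v × Incident f v)

  Connected : ESet → Set
  Connected S = ∀ T → T ⊆ S → Nonempty T → Nonempty (S ─ T) →
    ∃[ e ] ∃[ f ] (e ∈ T × f ∈ (S ─ T) × Adjacent e f)

  -- cycle: nonempty connected subgraph in which every vertex has degree 2
  -- (loops are 1-cycles, pairs of parallel edges are 2-cycles)
  IsCycle : ESet → Set
  IsCycle C = Nonempty C × Connected C × (∀ v → (deg C v ≡ 0) ⊎ (deg C v ≡ 2))

  -- theta subgraph: a subdivision of the graph with two vertices and
  -- three parallel edges; i.e. connected, bridgeless, exactly two
  -- vertices of degree 3 and all other vertices of degree 2.
  IsTheta : ESet → Set
  IsTheta T = Connected T
    × (∀ e → e ∈ T → Connected (T ─ ⁅ e ⁆))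
    × (∃[ u ] ∃[ w ] (u ≢ w × deg T u ≡ 3 × deg T w ≡ 3
         × (∀ v → v ≢ u → v ≢ w → (deg T v ≡ 0) ⊎ (deg T v ≡ 2))))

  IsPath : ESet → Fin n → Fin n → Set
  IsPath P u w = u ≢ w × Connected P × deg P u ≡ 1 × deg P w ≡ 1
    × (∀ v → v ≢ u → v ≢ w → (deg P v ≡ 0) ⊎ (deg P v ≡ 2))

  Disjoint : ESet → ESet → Set
  Disjoint S T = Empty (S ∩ T)

  VertexDisjoint : ESet → ESet → Set
  VertexDisjoint S T = ∀ v → VertexOf S v → ¬ VertexOf T v

  TightHandcuff : ESet → ESet → ESet → Set
  TightHandcuff C₁ C₂ H = IsCycle C₁ × IsCycle C₂ × Disjoint C₁ C₂
    × (∃[ x ] (VertexOf C₁ x × VertexOf C₂ x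
         × (∀ v → VertexOf C₁ v → VertexOf C₂ v → v ≡ x)))
    × H ≡ C₁ ∪ C₂

  LooseHandcuff : ESet → ESet → ESet → Set
  LooseHandcuff C₁ C₂ H = IsCycle C₁ × IsCycle C₂ × VertexDisjoint C₁ C₂
    × (∃[ P ] ∃[ u ] ∃[ w ] (IsPath P u w × VertexOf C₁ u × VertexOf C₂ w
         × (∀ v → VertexOf P v → v ≢ u → v ≢ w →
              ¬ VertexOf C₁ v × ¬ VertexOf C₂ v)
         × H ≡ (C₁ ∪ C₂) ∪ P))

  record QuasiBiased : Set₁ where
    field
      𝓑 𝓛 𝓕 : ESet → Set
      𝓑-cycle : ∀ C → 𝓑 C → IsCycle C
      𝓛-cycle : ∀ C → 𝓛 C → IsCycle C
      𝓕-cycle : ∀ C → 𝓕 C → IsCycle C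
      cover   : ∀ C → IsCycle C → 𝓑 C ⊎ 𝓛 C ⊎ 𝓕 C
      𝓑𝓛-disj : ∀ C → 𝓑 C → ¬ 𝓛 C
      𝓑𝓕-disj : ∀ C → 𝓑 C → ¬ 𝓕 C
      𝓛𝓕-disj : ∀ C → 𝓛 C → ¬ 𝓕 C
      -- no theta subgraph contains exactly two cycles of 𝓑
      -- (a theta contains exactly three cycles)
      theta   : ∀ T → IsTheta T → ∀ C₁ C₂ C₃ →
        IsCycle C₁ → IsCycle C₂ → IsCycle C₃ →
        C₁ ⊆ T → C₂ ⊆ T → C₃ ⊆ T →
        C₁ ≢ C₂ → C₁ ≢ C₃ → C₂ ≢ C₃ →
        ¬ (𝓑 C₁ × 𝓑 C₂ × ¬ 𝓑 C₃)
      𝓛𝓕-meet : ∀ C D → 𝓛 C → 𝓕 D → ∃[ v ] (VertexOf C v × VertexOf D v)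

  module _ (Q : QuasiBiased) where
    open QuasiBiased Q

    Circuit : ESet → Set
    Circuit X =
        𝓑 X
      ⊎ (IsTheta X × (∀ C → IsCycle C → C ⊆ X → ¬ 𝓑 C))
      ⊎ (∃[ C₁ ] ∃[ C₂ ] (TightHandcuff C₁ C₂ X × ¬ 𝓑 C₁ × ¬ 𝓑 C₂))
      ⊎ (∃[ C₁ ] ∃[ C₂ ] (𝓛 C₁ × 𝓛 C₂ × VertexDisjoint C₁ C₂ × X ≡ C₁ ∪ C₂))
      ⊎ (∃[ C₁ ] ∃[ C₂ ] (LooseHandcuff C₁ C₂ X × 𝓕 C₁ × 𝓕 C₂))

    InClosure : ESet → Fin m → Set
    InClosure X e = e ∈ X ⊎ ∃[ C ] (Circuit C × e ∈ C × C ⊆ (X ∪ ⁅ e ⁆))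

    Flat : ESet → Set
    Flat X = ∀ e → InClosure X e → e ∈ X

    inducedEdges : VSet → ESet
    inducedEdges U = Data.Vec.tabulate λ e →
      lookup U (end₁ e) Data.Bool.∧ lookup U (end₂ e)
      where import Data.Vec; import Data.Bool

    IsLoopsIn : (ESet → Set) → ESet → Set
    IsLoopsIn 𝓒 S = ∀ e → (e ∈ S → isLoop e × 𝓒 ⁅ e ⁆) × (isLoop e → 𝓒 ⁅ e ⁆ → e ∈ S)

{-# OPTIONS --safe #-}

-- Let X be E(G[U]) plus the chosen loops, and let e ∉ X lie in a circuit
-- C ⊆ X ∪ {e}.  Some end v of e lies outside U, so every other edge of C at v
-- is a loop of X, hence in 𝓑 or 𝓛 and not in 𝓕.  Degree counting (a cycle
-- through a loop is that loop; thetas and paths have no loops; cycles and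
-- thetas have no vertex of degree 1) shows that if e is not a loop, every
-- circuit through e has a second edge at v that is a non-loop or an 𝓕-loop.
-- If e is a loop at v, then {e} ∈ 𝓑, or C has a second edge at v that is not
-- a 𝓑-loop, or C contains an 𝓛-cycle avoiding e, which then lies in G[U].
-- When G[U] does contain an 𝓛-cycle, it must meet every 𝓕-cycle, so the loop
-- {e} at v ∉ U is in 𝓑 or 𝓛 and e is already one of the chosen loops.
module Submission where

open import Defs
open import Data.Fin.Subset using (_⊆_; _∪_)
open import Data.Product using (∃-syntax; _×_)
open import Relation.Nullary using (¬_)

open import Algebra.Properties.CommutativeSemigroup using (x∙yz≈y∙xz)
open import Data.Bool using (true; false; if_then_else_; _∧_)
open import Data.Empty using (⊥; ⊥-elim)
open import Data.Fin using (Fin; zero; suc; _≟_)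
open import Data.Fin.Properties using (any?)
open import Data.Fin.Subset using (Subset; _∈_; _∉_; _∩_; _─_; _-_; ⁅_⁆; Empty) renaming (⊥ to ∅)
open import Data.Fin.Subset.Properties
  using (_∈?_; x∈⁅x⁆; x∈⁅y⁆⇒x≡y; x∈p∪q⁻; p⊆p∪q; q⊆p∪q; x∈p∩q⁺; p─⊥≡p; p─q⊆p;
         x∈p∧x≢y⇒x∈p-y; ⊆-antisym)
open import Data.Nat using (ℕ; _+_; _≤_; z≤n; s≤s; s≤s⁻¹)
open import Data.Nat.Properties
  using (+-identityʳ; +-commutativeSemigroup; m≤m+n; +-monoʳ-≤; +-monoˡ-≤; ≤-refl; ≤-reflexive;
         ≤-trans; ≤⇒≯; n≤1+n; 1+n≢0; suc-injective; module ≤-Reasoning)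
open import Data.Product using (_,_; proj₁; proj₂)
open import Data.Sum using (_⊎_; inj₁; inj₂; [_,_])
import Data.Sum as Sum
open import Data.Vec using ([]; _∷_; here; there; map; sum; allFin; lookup)
open import Data.Vec.Properties using (allFin-map; map-∘; lookup∘tabulate; []=⇒lookup; lookup⇒[]=)
open import Function using (_∘_)
open import Relation.Nullary using (Dec; yes; no)
open import Relation.Nullary.Decidable using (_×-dec_; _⊎-dec_)
open import Relation.Binary.PropositionalEquality
  using (_≡_; _≢_; refl; sym; trans; cong; cong₂; subst; module ≡-Reasoning)

-- deg G S v unfolds to sumOver S (λ e → endCount G e v).
sumOver : ∀ {m} → Subset m → (Fin m → ℕ) → ℕ
sumOver {m} S f = sum (map (λ i → if lookup S i then f i else 0) (allFin m))

sumOver-∷ : ∀ {m} s (S : Subset m) (f : Fin (ℕ.suc m) → ℕ) →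
  sumOver (s ∷ S) f ≡ (if s then f zero else 0) + sumOver S (f ∘ suc)
sumOver-∷ {m} s S f =
  trans (cong (sum ∘ map term) (allFin-map m))
        (cong (term zero +_) (cong sum (sym (map-∘ term suc (allFin m)))))
  where
  term : Fin (ℕ.suc m) → ℕ
  term i = if lookup (s ∷ S) i then f i else 0

sumOver-remove : ∀ {m} {S : Subset m} {i} (f : Fin m → ℕ) → i ∈ S →
  sumOver S f ≡ f i + sumOver (S - i) f
sumOver-remove {S = true ∷ S} f here = begin
  sumOver (true ∷ S) f                  ≡⟨ sumOver-∷ true S f ⟩
  f zero + sumOver S (f ∘ suc)          ≡⟨ cong (λ T → f zero + sumOver T (f ∘ suc)) (p─⊥≡p S) ⟨
  f zero + sumOver (S ─ ∅) (f ∘ suc)    ≡⟨ cong (f zero +_) (sumOver-∷ false (S ─ ∅) f) ⟨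
  f zero + sumOver (false ∷ (S ─ ∅)) f  ∎
  where open ≡-Reasoning
sumOver-remove {S = s ∷ S} {suc i} f (there i∈S) = begin
  sumOver (s ∷ S) f                            ≡⟨ sumOver-∷ s S f ⟩
  c + sumOver S (f ∘ suc)                      ≡⟨ cong (c +_) (sumOver-remove (f ∘ suc) i∈S) ⟩
  c + (f (suc i) + sumOver (S - i) (f ∘ suc))  ≡⟨ x∙yz≈y∙xz +-commutativeSemigroup c (f (suc i)) _ ⟩
  f (suc i) + (c + sumOver (S - i) (f ∘ suc))  ≡⟨ cong (f (suc i) +_) (sumOver-∷ s (S - i) f) ⟨
  f (suc i) + sumOver (s ∷ (S - i)) f          ∎
  where
  open ≡-Reasoning
  c = if s then f zero else 0

sumOver-zero : ∀ {m} (S : Subset m) (f : Fin m → ℕ) → (∀ i → i ∈ S → f i ≡ 0) → sumOver S f ≡ 0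
sumOver-zero []          f f≡0 = refl
sumOver-zero (true ∷ S)  f f≡0 = trans (sumOver-∷ true S f)
  (cong₂ _+_ (f≡0 zero here) (sumOver-zero S (f ∘ suc) (λ i → f≡0 (suc i) ∘ there)))
sumOver-zero (false ∷ S) f f≡0 = trans (sumOver-∷ false S f)
  (sumOver-zero S (f ∘ suc) (λ i → f≡0 (suc i) ∘ there))

x∈p─q⇒x∉q : ∀ {m} {p q : Subset m} {x} → x ∈ p ─ q → x ∉ q
x∈p─q⇒x∉q {p = _ ∷ _} {false ∷ _} here        ()
x∈p─q⇒x∉q {p = _ ∷ _} {_ ∷ _}     (there x∈) (there x∈q) = x∈p─q⇒x∉q x∈ x∈q

x∈p-y⇒x≢y : ∀ {m} {p : Subset m} {x y} → x ∈ p - y → x ≢ y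
x∈p-y⇒x≢y x∈p-y refl = x∈p─q⇒x∉q x∈p-y (x∈⁅x⁆ _)

∩≡∅⇒∉ : ∀ {m} {p q : Subset m} {x} → Empty (p ∩ q) → x ∈ p → x ∉ q
∩≡∅⇒∉ p∩q≡∅ x∈p x∈q = p∩q≡∅ (_ , x∈p∩q⁺ (x∈p , x∈q))

∧≡true⁻ : ∀ {x y} → x ∧ y ≡ true → x ≡ true × y ≡ true
∧≡true⁻ {true} {true} refl = refl , refl

zero-or-two⇒≤2 : ∀ {d} → d ≡ 0 ⊎ d ≡ 2 → d ≤ 2
zero-or-two⇒≤2 (inj₁ refl) = z≤n
zero-or-two⇒≤2 (inj₂ refl) = ≤-refl

zero-or-two⇒≢1 : ∀ {d} → d ≡ 0 ⊎ d ≡ 2 → d ≢ 1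
zero-or-two⇒≢1 (inj₁ refl) ()
zero-or-two⇒≢1 (inj₂ refl) ()

module Degrees (G : Graph) where
  open Graph G

  private variable
    e f h : Fin m
    v x : Fin n
    S : ESet G

  loop-incident : isLoop G f → Incident G f x → end₁ f ≡ x
  loop-incident lf (inj₁ e₁≡x) = e₁≡x
  loop-incident lf (inj₂ e₂≡x) = trans lf e₂≡x

  incident? : ∀ e v → Dec (Incident G e v)
  incident? e v = (end₁ e ≟ v) ⊎-dec (end₂ e ≟ v)

  endCount-unincident : ¬ Incident G e v → endCount G e v ≡ 0
  endCount-unincident {e} {v} e∤v with end₁ e ≟ v | end₂ e ≟ v
  ... | yes e₁≡v | _        = ⊥-elim (e∤v (inj₁ e₁≡v))
  ... | no _     | yes e₂≡v = ⊥-elim (e∤v (inj₂ e₂≡v))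
  ... | no _     | no _     = refl

  endCount-incident : Incident G e v → 1 ≤ endCount G e v
  endCount-incident {e} {v} e∣v with end₁ e ≟ v | end₂ e ≟ v
  ... | yes _    | _        = s≤s z≤n
  ... | no _     | yes _    = s≤s z≤n
  ... | no e₁≢v  | no e₂≢v  = ⊥-elim ([ e₁≢v , e₂≢v ] e∣v)

  endCount-loop : isLoop G e → Incident G e v → endCount G e v ≡ 2
  endCount-loop {e} {v} le e∣v with end₁ e ≟ v | end₂ e ≟ v
  ... | yes _    | yes _    = refl
  ... | no e₁≢v  | _        = ⊥-elim (e₁≢v (loop-incident le e∣v))
  ... | yes e₁≡v | no e₂≢v  = ⊥-elim (e₂≢v (trans (sym le) e₁≡v))

  endCount-nonloop : ¬ isLoop G e → Incident G e v → endCount G e v ≡ 1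
  endCount-nonloop {e} {v} nl e∣v with end₁ e ≟ v | end₂ e ≟ v
  ... | yes e₁≡v | yes e₂≡v = ⊥-elim (nl (trans e₁≡v (sym e₂≡v)))
  ... | yes _    | no _     = refl
  ... | no _     | yes _    = refl
  ... | no e₁≢v  | no e₂≢v  = ⊥-elim ([ e₁≢v , e₂≢v ] e∣v)

  endCount≤2 : endCount G e v ≤ 2
  endCount≤2 {e} {v} with end₁ e ≟ v | end₂ e ≟ v
  ... | yes _ | yes _ = ≤-refl
  ... | yes _ | no _  = s≤s z≤n
  ... | no _  | yes _ = s≤s z≤n
  ... | no _  | no _  = z≤n

  deg-remove : e ∈ S → deg G S v ≡ endCount G e v + deg G (S - e) v
  deg-remove {v = v} = sumOver-remove (λ g → endCount G g v)

  deg-unincident : (∀ g → g ∈ S → ¬ Incident G g v) → deg G S v ≡ 0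
  deg-unincident {S} {v} none =
    sumOver-zero S (λ g → endCount G g v) (λ g g∈S → endCount-unincident (none g g∈S))

  deg-sole : e ∈ S → (∀ g → g ∈ S → g ≢ e → ¬ Incident G g v) → deg G S v ≡ endCount G e v
  deg-sole {e} {S} {v} e∈S none = begin
    deg G S v                          ≡⟨ deg-remove e∈S ⟩
    endCount G e v + deg G (S - e) v   ≡⟨ cong (endCount G e v +_) (deg-unincident none′) ⟩
    endCount G e v + 0                 ≡⟨ +-identityʳ _ ⟩
    endCount G e v                     ∎
    where
    open ≡-Reasoning
    none′ : ∀ g → g ∈ S - e → ¬ Incident G g v
    none′ g g∈S-e = none g (p─q⊆p S ⁅ e ⁆ g∈S-e) (x∈p-y⇒x≢y g∈S-e)

  unincident-or-incident : ∀ S v →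
    (∀ g → g ∈ S → ¬ Incident G g v) ⊎ ∃[ g ] (g ∈ S × Incident G g v)
  unincident-or-incident S v with any? (λ g → g ∈? S ×-dec incident? g v)
  ... | yes found = inj₂ found
  ... | no none   = inj₁ (λ g g∈S g∣v → none (g , g∈S , g∣v))

  deg≡suc⇒incident : ∀ {k} → deg G S v ≡ ℕ.suc k → ∃[ g ] (g ∈ S × Incident G g v)
  deg≡suc⇒incident {S} {v} d≡1+k with unincident-or-incident S v
  ... | inj₁ none  = ⊥-elim (1+n≢0 (trans (sym d≡1+k) (deg-unincident none)))
  ... | inj₂ found = found

  deg-sole-or-neighbour : e ∈ S →
    deg G S v ≡ endCount G e v ⊎ ∃[ g ] (g ∈ S × g ≢ e × Incident G g v)
  deg-sole-or-neighbour {e} {S} {v} e∈S with unincident-or-incident (S - e) v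
  ... | inj₁ none = inj₁ (deg-sole e∈S λ g g∈S g≢e → none g (x∈p∧x≢y⇒x∈p-y g∈S g≢e))
  ... | inj₂ (g , g∈S-e , g∣v) = inj₂ (g , p─q⊆p S ⁅ e ⁆ g∈S-e , x∈p-y⇒x≢y g∈S-e , g∣v)

  deg-at-loop-with-neighbour : f ∈ S → isLoop G f → Incident G f v →
    h ∈ S → h ≢ f → Incident G h v → 3 ≤ deg G S v
  deg-at-loop-with-neighbour {f} {S} {v} {h} f∈S lf f∣v h∈S h≢f h∣v = begin
    3                                           ≤⟨ +-monoʳ-≤ 2 (endCount-incident h∣v) ⟩
    2 + endCount G h v                          ≤⟨ +-monoʳ-≤ 2 (m≤m+n _ _) ⟩
    2 + (endCount G h v + deg G (S - f - h) v)  ≡⟨ cong₂ _+_ (endCount-loop lf f∣v) h-removed ⟨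
    endCount G f v + deg G (S - f) v            ≡⟨ deg-remove f∈S ⟨
    deg G S v                                   ∎
    where
    open ≤-Reasoning
    h-removed : deg G (S - f) v ≡ endCount G h v + deg G (S - f - h) v
    h-removed = deg-remove (x∈p∧x≢y⇒x∈p-y h∈S h≢f)

module Subgraphs (G : Graph) where
  open Graph G
  open Degrees G

  private variable
    e f g : Fin m
    u v w x : Fin n
    S D P T : ESet G

  vertex-disjoint⇒∉ : VertexDisjoint G S T → e ∈ S → e ∉ T
  vertex-disjoint⇒∉ {e = e} disjoint e∈S e∈T =
    disjoint (end₁ e) (e , e∈S , inj₁ refl) (e , e∈T , inj₁ refl)

  loop-neighbour : Connected G S → f ∈ S → isLoop G f → e ∈ S → e ≢ f →
    ∃[ h ] (h ∈ S × h ≢ f × Incident G h (end₁ f))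
  loop-neighbour {S} {f} conn f∈S lf e∈S e≢f
    with conn ⁅ f ⁆ (λ g∈⁅f⁆ → subst (_∈ S) (sym (x∈⁅y⁆⇒x≡y f g∈⁅f⁆)) f∈S)
              (f , x∈⁅x⁆ f) (_ , x∈p∧x≢y⇒x∈p-y e∈S e≢f)
  ... | g , h , g∈⁅f⁆ , h∈S-f , x , g∣x , h∣x with x∈⁅y⁆⇒x≡y f g∈⁅f⁆
  ... | refl = h , p─q⊆p S ⁅ f ⁆ h∈S-f , x∈p-y⇒x≢y h∈S-f ,
               subst (Incident G h) (sym (loop-incident lf g∣x)) h∣x

  loop-isolated : Connected G S → f ∈ S → isLoop G f → deg G S (end₁ f) ≤ 2 → g ∈ S → g ≡ f
  loop-isolated {f = f} {g = g} conn f∈S lf deg≤2 g∈S with g ≟ f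
  ... | yes g≡f = g≡f
  ... | no g≢f with loop-neighbour conn f∈S lf g∈S g≢f
  ... | h , h∈S , h≢f , h∣v =
    ⊥-elim (≤⇒≯ deg≤2 (deg-at-loop-with-neighbour f∈S lf (inj₁ refl) h∈S h≢f h∣v))

  cycle-loop-unique : IsCycle G D → f ∈ D → isLoop G f → g ∈ D → g ≡ f
  cycle-loop-unique {f = f} (_ , conn , degs) f∈D lf =
    loop-isolated conn f∈D lf (zero-or-two⇒≤2 (degs (end₁ f)))

  cycle-loop-singleton : IsCycle G D → f ∈ D → isLoop G f → D ≡ ⁅ f ⁆
  cycle-loop-singleton {D} {f} cyc f∈D lf = ⊆-antisym
    (λ g∈D → subst (_∈ ⁅ f ⁆) (sym (cycle-loop-unique cyc f∈D lf g∈D)) (x∈⁅x⁆ f))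
    (λ g∈⁅f⁆ → subst (_∈ D) (sym (x∈⁅y⁆⇒x≡y f g∈⁅f⁆)) f∈D)

  cycle-loop-vertex : IsCycle G D → f ∈ D → isLoop G f → VertexOf G D x → end₁ f ≡ x
  cycle-loop-vertex cyc f∈D lf (g , g∈D , g∣x) with cycle-loop-unique cyc f∈D lf g∈D
  ... | refl = loop-incident lf g∣x

  singleton-connected : Connected G ⁅ e ⁆
  singleton-connected {e} T T⊆⁅e⁆ (t , t∈T) (s , s∈⁅e⁆─T) = ⊥-elim (x∈p─q⇒x∉q s∈⁅e⁆─T s∈T)
    where
    t≡s : t ≡ s
    t≡s = trans (x∈⁅y⁆⇒x≡y e (T⊆⁅e⁆ t∈T)) (sym (x∈⁅y⁆⇒x≡y e (p─q⊆p ⁅ e ⁆ T s∈⁅e⁆─T)))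
    s∈T : s ∈ T
    s∈T = subst (_∈ T) t≡s t∈T

  loop-cycle : isLoop G e → IsCycle G ⁅ e ⁆
  loop-cycle {e} le = (e , x∈⁅x⁆ e) , singleton-connected , degree
    where
    deg≡endCount : ∀ v → deg G ⁅ e ⁆ v ≡ endCount G e v
    deg≡endCount v = deg-sole (x∈⁅x⁆ e) (λ g g∈⁅e⁆ g≢e _ → g≢e (x∈⁅y⁆⇒x≡y e g∈⁅e⁆))
    degree : ∀ v → deg G ⁅ e ⁆ v ≡ 0 ⊎ deg G ⁅ e ⁆ v ≡ 2
    degree v with incident? e v
    ... | yes e∣v = inj₂ (trans (deg≡endCount v) (endCount-loop le e∣v))
    ... | no e∤v  = inj₁ (trans (deg≡endCount v) (endCount-unincident e∤v))

  cycle-nonloop-neighbour : IsCycle G D → e ∈ D → ¬ isLoop G e → Incident G e v →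
    ∃[ g ] (g ∈ D × g ≢ e × Incident G g v × ¬ isLoop G g)
  cycle-nonloop-neighbour {v = v} cyc@(_ , _ , degs) e∈D nl e∣v
    with deg-sole-or-neighbour {v = v} e∈D
  ... | inj₁ d≡endCount =
    ⊥-elim (zero-or-two⇒≢1 (degs v) (trans d≡endCount (endCount-nonloop nl e∣v)))
  ... | inj₂ (g , g∈D , g≢e , g∣v) =
    g , g∈D , g≢e , g∣v , λ lg → g≢e (sym (cycle-loop-unique cyc g∈D lg e∈D))

  theta-deg≤3 : IsTheta G T → ∀ v → deg G T v ≤ 3
  theta-deg≤3 (_ , _ , u , w , _ , du , dw , rest) v with v ≟ u | v ≟ w
  ... | yes refl | _        = ≤-reflexive du
  ... | no _     | yes refl = ≤-reflexive dw
  ... | no v≢u   | no v≢w   = ≤-trans (zero-or-two⇒≤2 (rest v v≢u v≢w)) (n≤1+n 2)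

  theta-deg≢1 : IsTheta G T → ∀ v → deg G T v ≢ 1
  theta-deg≢1 (_ , _ , u , w , _ , du , dw , rest) v with v ≟ u | v ≟ w
  ... | yes refl | _        = λ d≡1 → 1+n≢0 (suc-injective (trans (sym du) d≡1))
  ... | no _     | yes refl = λ d≡1 → 1+n≢0 (suc-injective (trans (sym dw) d≡1))
  ... | no v≢u   | no v≢w   = zero-or-two⇒≢1 (rest v v≢u v≢w)

  theta-branch-vertex-avoiding : IsTheta G T → ∀ v → ∃[ w ] (w ≢ v × deg G T w ≡ 3)
  theta-branch-vertex-avoiding (_ , _ , u , w , u≢w , du , dw , _) v with u ≟ v
  ... | yes refl = w , (λ w≡u → u≢w (sym w≡u)) , dw
  ... | no u≢v   = u , u≢v , du

  -- An edge meets the branch vertex w′ ≠ end₁ f, so by connectivity end₁ f has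
  -- degree 3: the loop f plus one edge k.  Deleting k (T is bridgeless) leaves
  -- f isolated, so k alone would have to give w′ degree 3.
  theta-loopless : IsTheta G T → f ∈ T → ¬ isLoop G f
  theta-loopless {T} {f} θ@(conn , bridgeless , _) f∈T lf
    with theta-branch-vertex-avoiding θ (end₁ f)
  ... | w′ , w′≢f₁ , deg-w′≡3 with deg≡suc⇒incident deg-w′≡3
  ... | h , h∈T , h∣w′
    with loop-neighbour conn f∈T lf h∈T (λ { refl → w′≢f₁ (sym (loop-incident lf h∣w′)) })
  ... | k , k∈T , k≢f , k∣f₁ = ≤⇒≯ deg-w′≤2 (≤-reflexive (sym deg-w′≡3))
    where
    deg-T-k≤2 : deg G (T - k) (end₁ f) ≤ 2
    deg-T-k≤2 = s≤s⁻¹ (begin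
      1 + deg G (T - k) (end₁ f)                      ≤⟨ +-monoˡ-≤ _ (endCount-incident k∣f₁) ⟩
      endCount G k (end₁ f) + deg G (T - k) (end₁ f)  ≡⟨ deg-remove k∈T ⟨
      deg G T (end₁ f)                                ≤⟨ theta-deg≤3 θ (end₁ f) ⟩
      3                                               ∎)
      where open ≤-Reasoning
    only-f : ∀ {g} → g ∈ T - k → g ≡ f
    only-f = loop-isolated (bridgeless k k∈T) (x∈p∧x≢y⇒x∈p-y f∈T (k≢f ∘ sym)) lf deg-T-k≤2
    T-k∤w′ : ∀ g → g ∈ T - k → ¬ Incident G g w′
    T-k∤w′ g g∈T-k g∣w′ with only-f g∈T-k
    ... | refl = w′≢f₁ (sym (loop-incident lf g∣w′))
    deg-w′≤2 : deg G T w′ ≤ 2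
    deg-w′≤2 = begin
      deg G T w′                          ≡⟨ deg-remove k∈T ⟩
      endCount G k w′ + deg G (T - k) w′  ≡⟨ cong (endCount G k w′ +_) (deg-unincident T-k∤w′) ⟩
      endCount G k w′ + 0                 ≡⟨ +-identityʳ _ ⟩
      endCount G k w′                     ≤⟨ endCount≤2 ⟩
      2                                   ∎
      where open ≤-Reasoning

  path-deg≤2 : IsPath G P u w → ∀ x → deg G P x ≤ 2
  path-deg≤2 {u = u} {w} (_ , _ , du , dw , rest) x with x ≟ u | x ≟ w
  ... | yes refl | _        = ≤-trans (≤-reflexive du) (n≤1+n 1)
  ... | no _     | yes refl = ≤-trans (≤-reflexive dw) (n≤1+n 1)
  ... | no x≢u   | no x≢w   = zero-or-two⇒≤2 (rest x x≢u x≢w)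

  path-deg1⇒end : IsPath G P u w → deg G P x ≡ 1 → x ≡ u ⊎ x ≡ w
  path-deg1⇒end {u = u} {w} {x} (_ , _ , _ , _ , rest) d≡1 with x ≟ u | x ≟ w
  ... | yes x≡u | _        = inj₁ x≡u
  ... | no _    | yes x≡w  = inj₂ x≡w
  ... | no x≢u  | no x≢w   = ⊥-elim (zero-or-two⇒≢1 (rest x x≢u x≢w) d≡1)

  path-loopless : IsPath G P u w → f ∈ P → ¬ isLoop G f
  path-loopless {P} {f = f} π@(u≢w , conn , du , dw , _) f∈P lf =
    u≢w (trans (sym (end-at-loop du)) (end-at-loop dw))
    where
    end-at-loop : deg G P x ≡ 1 → end₁ f ≡ x
    end-at-loop dx≡1 with deg≡suc⇒incident dx≡1
    ... | g , g∈P , g∣x with loop-isolated conn f∈P lf (path-deg≤2 π (end₁ f)) g∈P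
    ... | refl = loop-incident lf g∣x

module Circuits (G : Graph) (Q : QuasiBiased G) where
  open Graph G
  open QuasiBiased Q
  open Degrees G
  open Subgraphs G

  private variable
    e g : Fin m
    v x : Fin n
    C D : ESet G

  NeighbourAt : (Fin m → Set) → ESet G → Fin m → Fin n → Set
  NeighbourAt Good C e v = ∃[ g ] (g ∈ C × g ≢ e × Incident G g v × Good g)

  𝓕-IfLoop : Fin m → Set
  𝓕-IfLoop g = isLoop G g → 𝓕 ⁅ g ⁆

  𝓑-Loop : Fin m → Set
  𝓑-Loop g = isLoop G g × 𝓑 ⁅ g ⁆

  𝓑-loop⇒𝓑-cycle : IsCycle G D → g ∈ D → 𝓑-Loop g → 𝓑 D
  𝓑-loop⇒𝓑-cycle cyc g∈D (lg , 𝓑g) = subst 𝓑 (sym (cycle-loop-singleton cyc g∈D lg)) 𝓑g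

  cycle-neighbour : IsCycle G D → D ⊆ C → e ∈ D → ¬ isLoop G e → Incident G e v →
    NeighbourAt 𝓕-IfLoop C e v
  cycle-neighbour cyc D⊆C e∈D nl e∣v with cycle-nonloop-neighbour cyc e∈D nl e∣v
  ... | g , g∈D , g≢e , g∣v , nlg = g , D⊆C g∈D , g≢e , g∣v , ⊥-elim ∘ nlg

  union-neighbour : ∀ {C₁ C₂} → IsCycle G C₁ → IsCycle G C₂ → C₁ ∪ C₂ ⊆ C →
    e ∈ C₁ ∪ C₂ → ¬ isLoop G e → Incident G e v → NeighbourAt 𝓕-IfLoop C e v
  union-neighbour {C₁ = C₁} {C₂} cyc₁ cyc₂ C₁∪C₂⊆C e∈C₁∪C₂ with x∈p∪q⁻ C₁ C₂ e∈C₁∪C₂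
  ... | inj₁ e∈C₁ = cycle-neighbour cyc₁ (λ g∈C₁ → C₁∪C₂⊆C (p⊆p∪q C₂ g∈C₁)) e∈C₁
  ... | inj₂ e∈C₂ = cycle-neighbour cyc₂ (λ g∈C₂ → C₁∪C₂⊆C (q⊆p∪q C₁ C₂ g∈C₂)) e∈C₂

  𝓕-cycle-neighbour : IsCycle G D → 𝓕 D → D ⊆ C → ¬ isLoop G e → Incident G e v →
    VertexOf G D v → NeighbourAt 𝓕-IfLoop C e v
  𝓕-cycle-neighbour {e = e} cyc 𝓕D D⊆C nl e∣v (g , g∈D , g∣v) with g ≟ e
  ... | yes refl = cycle-neighbour cyc D⊆C g∈D nl e∣v
  ... | no g≢e   = g , D⊆C g∈D , g≢e , g∣v , λ lg → subst 𝓕 (cycle-loop-singleton cyc g∈D lg) 𝓕D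

  -- Cycles and thetas have no vertex of degree 1, and a path of a loose
  -- handcuff whose end is v ends there on an 𝓕-cycle.
  circuit-nonloop-neighbour : Circuit G Q C → e ∈ C → ¬ isLoop G e → Incident G e v →
    NeighbourAt 𝓕-IfLoop C e v
  circuit-nonloop-neighbour (inj₁ 𝓑C) = cycle-neighbour (𝓑-cycle _ 𝓑C) (λ g∈C → g∈C)
  circuit-nonloop-neighbour {v = v} (inj₂ (inj₁ (θ , _))) e∈C nl e∣v
    with deg-sole-or-neighbour {v = v} e∈C
  ... | inj₁ d≡endCount = ⊥-elim (theta-deg≢1 θ v (trans d≡endCount (endCount-nonloop nl e∣v)))
  ... | inj₂ (g , g∈C , g≢e , g∣v) = g , g∈C , g≢e , g∣v , ⊥-elim ∘ theta-loopless θ g∈C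
  circuit-nonloop-neighbour (inj₂ (inj₂ (inj₁ (_ , _ , (cyc₁ , cyc₂ , _ , _ , refl) , _)))) =
    union-neighbour cyc₁ cyc₂ (λ g∈C → g∈C)
  circuit-nonloop-neighbour (inj₂ (inj₂ (inj₂ (inj₁ (_ , _ , 𝓛C₁ , 𝓛C₂ , _ , refl))))) =
    union-neighbour (𝓛-cycle _ 𝓛C₁) (𝓛-cycle _ 𝓛C₂) (λ g∈C → g∈C)
  circuit-nonloop-neighbour {v = v}
    (inj₂ (inj₂ (inj₂ (inj₂ (C₁ , C₂ ,
      (cyc₁ , cyc₂ , _ , P , _ , _ , π , u∈C₁ , w∈C₂ , _ , refl) , 𝓕C₁ , 𝓕C₂)))))
    e∈C nl e∣v with x∈p∪q⁻ (C₁ ∪ C₂) P e∈C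
  ... | inj₁ e∈C₁∪C₂ = union-neighbour cyc₁ cyc₂ (p⊆p∪q P) e∈C₁∪C₂ nl e∣v
  ... | inj₂ e∈P with deg-sole-or-neighbour {v = v} e∈P
  ...   | inj₂ (g , g∈P , g≢e , g∣v) = g , q⊆p∪q _ P g∈P , g≢e , g∣v , ⊥-elim ∘ path-loopless π g∈P
  ...   | inj₁ d≡endCount with path-deg1⇒end π (trans d≡endCount (endCount-nonloop nl e∣v))
  ...     | inj₁ refl = 𝓕-cycle-neighbour cyc₁ 𝓕C₁ (λ g∈C₁ → p⊆p∪q P (p⊆p∪q C₂ g∈C₁)) nl e∣v u∈C₁
  ...     | inj₂ refl = 𝓕-cycle-neighbour cyc₂ 𝓕C₂ (λ g∈C₂ → p⊆p∪q P (q⊆p∪q C₁ C₂ g∈C₂)) nl e∣v w∈C₂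

  tight-neighbour : ∀ {Cᵢ Cⱼ} → IsCycle G Cᵢ → IsCycle G Cⱼ → (∀ {g} → g ∈ Cᵢ → g ∉ Cⱼ) →
    ¬ 𝓑 Cⱼ → Cⱼ ⊆ C → e ∈ Cᵢ → isLoop G e → VertexOf G Cᵢ x → VertexOf G Cⱼ x →
    NeighbourAt (¬_ ∘ 𝓑-Loop) C e (end₁ e)
  tight-neighbour cycᵢ cycⱼ disjoint ¬𝓑Cⱼ Cⱼ⊆C e∈Cᵢ le x∈Cᵢ (g , g∈Cⱼ , g∣x)
    with cycle-loop-vertex cycᵢ e∈Cᵢ le x∈Cᵢ
  ... | refl = g , Cⱼ⊆C g∈Cⱼ , (λ { refl → disjoint e∈Cᵢ g∈Cⱼ }) , g∣x ,
               ¬𝓑Cⱼ ∘ 𝓑-loop⇒𝓑-cycle cycⱼ g∈Cⱼ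

  path-end-neighbour : ∀ {P u w} → IsPath G P u w → P ⊆ C → IsCycle G D → e ∈ D → isLoop G e →
    VertexOf G D x → deg G P x ≡ 1 → NeighbourAt (¬_ ∘ 𝓑-Loop) C e (end₁ e)
  path-end-neighbour π P⊆C cyc e∈D le x∈D dx≡1 with cycle-loop-vertex cyc e∈D le x∈D
  ... | refl with deg≡suc⇒incident dx≡1
  ... | g , g∈P , g∣x =
    g , P⊆C g∈P , (λ { refl → path-loopless π g∈P le }) , g∣x , path-loopless π g∈P ∘ proj₁

  circuit-loop-alternatives : Circuit G Q C → e ∈ C → isLoop G e →
    𝓑 ⁅ e ⁆ ⊎ NeighbourAt (¬_ ∘ 𝓑-Loop) C e (end₁ e) ⊎ ∃[ D ] (D ⊆ C × e ∉ D × 𝓛 D)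
  circuit-loop-alternatives (inj₁ 𝓑C) e∈C le =
    inj₁ (subst 𝓑 (cycle-loop-singleton (𝓑-cycle _ 𝓑C) e∈C le) 𝓑C)
  circuit-loop-alternatives (inj₂ (inj₁ (θ , _))) e∈C le = ⊥-elim (theta-loopless θ e∈C le)
  circuit-loop-alternatives
    (inj₂ (inj₂ (inj₁ (C₁ , C₂ ,
      (cyc₁ , cyc₂ , C₁∩C₂≡∅ , (_ , x∈C₁ , x∈C₂ , _) , refl) , ¬𝓑C₁ , ¬𝓑C₂))))
    e∈C le with x∈p∪q⁻ C₁ C₂ e∈C
  ... | inj₁ e∈C₁ = inj₂ (inj₁ (tight-neighbour cyc₁ cyc₂ (∩≡∅⇒∉ C₁∩C₂≡∅)
                                   ¬𝓑C₂ (q⊆p∪q C₁ C₂) e∈C₁ le x∈C₁ x∈C₂))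
  ... | inj₂ e∈C₂ = inj₂ (inj₁ (tight-neighbour cyc₂ cyc₁ (λ g∈C₂ g∈C₁ → ∩≡∅⇒∉ C₁∩C₂≡∅ g∈C₁ g∈C₂)
                                   ¬𝓑C₁ (p⊆p∪q C₂) e∈C₂ le x∈C₂ x∈C₁))
  circuit-loop-alternatives
    (inj₂ (inj₂ (inj₂ (inj₁ (C₁ , C₂ , 𝓛C₁ , 𝓛C₂ , vertex-disjoint , refl))))) e∈C le
    with x∈p∪q⁻ C₁ C₂ e∈C
  ... | inj₁ e∈C₁ = inj₂ (inj₂ (C₂ , q⊆p∪q C₁ C₂ , vertex-disjoint⇒∉ vertex-disjoint e∈C₁ , 𝓛C₂))
  ... | inj₂ e∈C₂ =
    inj₂ (inj₂ (C₁ , p⊆p∪q C₂ , (λ e∈C₁ → vertex-disjoint⇒∉ vertex-disjoint e∈C₁ e∈C₂) , 𝓛C₁))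
  circuit-loop-alternatives
    (inj₂ (inj₂ (inj₂ (inj₂ (C₁ , C₂ ,
      (cyc₁ , cyc₂ , _ , P , _ , _ , π@(_ , _ , du , dw , _) , u∈C₁ , w∈C₂ , _ , refl) , _)))))
    e∈C le with x∈p∪q⁻ (C₁ ∪ C₂) P e∈C
  ... | inj₂ e∈P = ⊥-elim (path-loopless π e∈P le)
  ... | inj₁ e∈C₁∪C₂ with x∈p∪q⁻ C₁ C₂ e∈C₁∪C₂
  ...   | inj₁ e∈C₁ = inj₂ (inj₁ (path-end-neighbour π (q⊆p∪q (C₁ ∪ C₂) P) cyc₁ e∈C₁ le u∈C₁ du))
  ...   | inj₂ e∈C₂ = inj₂ (inj₁ (path-end-neighbour π (q⊆p∪q (C₁ ∪ C₂) P) cyc₂ e∈C₂ le w∈C₂ dw))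

module InducedFlats (G : Graph) (Q : QuasiBiased G) (U : VSet G) where
  open Graph G
  open QuasiBiased Q
  open Degrees G
  open Subgraphs G
  open Circuits G Q

  private variable
    e g : Fin m
    x : Fin n

  I : ESet G
  I = inducedEdges G Q U

  induced-ends : g ∈ I → end₁ g ∈ U × end₂ g ∈ U
  induced-ends {g} g∈I =
    let e₁∈U , e₂∈U = ∧≡true⁻ {lookup U (end₁ g)} (trans (sym (lookup∘tabulate _ g)) ([]=⇒lookup g∈I))
    in lookup⇒[]= _ U e₁∈U , lookup⇒[]= _ U e₂∈U

  induced-incident : g ∈ I → Incident G g x → x ∈ U
  induced-incident g∈I (inj₁ refl) = proj₁ (induced-ends g∈I)
  induced-incident g∈I (inj₂ refl) = proj₂ (induced-ends g∈I)

  not-induced : g ∉ I → ∃[ v ] (Incident G g v × v ∉ U)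
  not-induced {g} g∉I with end₁ g ∈? U | end₂ g ∈? U
  ... | no e₁∉U   | _         = end₁ g , inj₁ refl , e₁∉U
  ... | yes _     | no e₂∉U   = end₂ g , inj₂ refl , e₂∉U
  ... | yes e₁∈U  | yes e₂∈U  = ⊥-elim (g∉I (lookup⇒[]= g I
        (trans (lookup∘tabulate _ g) (cong₂ _∧_ ([]=⇒lookup e₁∈U) ([]=⇒lookup e₂∈U)))))

  ∈-∪-⁅⁆ : ∀ {X : ESet G} → g ∈ X ∪ ⁅ e ⁆ → g ≢ e → g ∈ X
  ∈-∪-⁅⁆ {e = e} {X} g∈X∪e g≢e with x∈p∪q⁻ X ⁅ e ⁆ g∈X∪e
  ... | inj₁ g∈X = g∈X
  ... | inj₂ g∈⁅e⁆ = ⊥-elim (g≢e (x∈⁅y⁆⇒x≡y e g∈⁅e⁆))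

  LoopClosed : ESet G → Set
  LoopClosed X = ∀ e C → isLoop G e → e ∉ X → end₁ e ∉ U →
    Circuit G Q C → e ∈ C → C ⊆ X ∪ ⁅ e ⁆ → ⊥

  -- A non-loop e ∉ X has an end v ∉ U, at which the circuit would need a
  -- further edge that is neither induced nor a loop outside 𝓕.
  flat-criterion : (X : ESet G) → I ⊆ X →
    (∀ g → g ∈ X → g ∈ I ⊎ (isLoop G g × ¬ 𝓕 ⁅ g ⁆)) → LoopClosed X → Flat G Q X
  flat-criterion X I⊆X classify loop-case e (inj₁ e∈X) = e∈X
  flat-criterion X I⊆X classify loop-case e (inj₂ (C , circ , e∈C , C⊆X∪e)) with e ∈? X
  ... | yes e∈X = e∈X
  ... | no e∉X with not-induced (e∉X ∘ I⊆X)
  ... | v , e∣v , v∉U with end₁ e ≟ end₂ e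
  ...   | yes le = ⊥-elim (loop-case e C le e∉X e₁∉U circ e∈C C⊆X∪e)
    where
    e₁∉U : end₁ e ∉ U
    e₁∉U e₁∈U = v∉U (subst (_∈ U) (loop-incident le e∣v) e₁∈U)
  ...   | no nl with circuit-nonloop-neighbour circ e∈C nl e∣v
  ...     | g , g∈C , g≢e , g∣v , loop⇒𝓕 with classify g (∈-∪-⁅⁆ (C⊆X∪e g∈C) g≢e)
  ...       | inj₁ g∈I = ⊥-elim (v∉U (induced-incident g∈I g∣v))
  ...       | inj₂ (lg , ¬𝓕g) = ⊥-elim (¬𝓕g (loop⇒𝓕 lg))

  loops-outside-𝓕 : ∀ {𝓒 L} → IsLoopsIn G Q 𝓒 L → (∀ C → 𝓒 C → ¬ 𝓕 C) →
    g ∈ L → isLoop G g × ¬ 𝓕 ⁅ g ⁆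
  loops-outside-𝓕 {g = g} loops disj g∈L with proj₁ (loops g) g∈L
  ... | lg , 𝓒g = lg , disj ⁅ g ⁆ 𝓒g

  I∪LB-loop-closed : ∀ {LB} → IsLoopsIn G Q 𝓑 LB → ¬ (∃[ C ] (C ⊆ I × 𝓛 C)) → LoopClosed (I ∪ LB)
  I∪LB-loop-closed {LB} loopsB no𝓛 e C le e∉X e₁∉U circ e∈C C⊆X∪e
    with circuit-loop-alternatives circ e∈C le
  ... | inj₁ 𝓑e = e∉X (q⊆p∪q I LB (proj₂ (loopsB e) le 𝓑e))
  ... | inj₂ (inj₁ (g , g∈C , g≢e , g∣v , ¬𝓑g)) with x∈p∪q⁻ I LB (∈-∪-⁅⁆ (C⊆X∪e g∈C) g≢e)
  ...   | inj₁ g∈I  = e₁∉U (induced-incident g∈I g∣v)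
  ...   | inj₂ g∈LB = ¬𝓑g (proj₁ (loopsB g) g∈LB)
  I∪LB-loop-closed {LB} loopsB no𝓛 e C le e∉X e₁∉U circ e∈C C⊆X∪e
      | inj₂ (inj₂ (D , D⊆C , e∉D , 𝓛D)) = no𝓛 (D , D⊆I , 𝓛D)
    where
    D⊆I : D ⊆ I
    D⊆I {g} g∈D with x∈p∪q⁻ I LB (∈-∪-⁅⁆ (C⊆X∪e (D⊆C g∈D)) (λ { refl → e∉D g∈D }))
    ... | inj₁ g∈I  = g∈I
    ... | inj₂ g∈LB =
      ⊥-elim (𝓑𝓛-disj D (𝓑-loop⇒𝓑-cycle (𝓛-cycle D 𝓛D) g∈D (proj₁ (loopsB g) g∈LB)) 𝓛D)

  𝓛-cycle-in-I⇒¬𝓕-loop : ∃[ C ] (C ⊆ I × 𝓛 C) → isLoop G e → end₁ e ∉ U → ¬ 𝓕 ⁅ e ⁆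
  𝓛-cycle-in-I⇒¬𝓕-loop {e} (C , C⊆I , 𝓛C) le e₁∉U 𝓕e with 𝓛𝓕-meet C ⁅ e ⁆ 𝓛C 𝓕e
  ... | x , (g , g∈C , g∣x) , x∈⁅e⁆ = e₁∉U (subst (_∈ U) (sym e₁≡x) (induced-incident (C⊆I g∈C) g∣x))
    where
    e₁≡x : end₁ e ≡ x
    e₁≡x = cycle-loop-vertex (loop-cycle le) (x∈⁅x⁆ e) le x∈⁅e⁆

  I∪LB∪LL-loop-closed : ∀ {LB LL} → IsLoopsIn G Q 𝓑 LB → IsLoopsIn G Q 𝓛 LL →
    ∃[ C ] (C ⊆ I × 𝓛 C) → LoopClosed ((I ∪ LB) ∪ LL)
  I∪LB∪LL-loop-closed {LB} {LL} loopsB loopsL has𝓛 e _ le e∉X e₁∉U _ _ _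
    with cover ⁅ e ⁆ (loop-cycle le)
  ... | inj₁ 𝓑e        = e∉X (p⊆p∪q LL (q⊆p∪q I LB (proj₂ (loopsB e) le 𝓑e)))
  ... | inj₂ (inj₁ 𝓛e) = e∉X (q⊆p∪q (I ∪ LB) LL (proj₂ (loopsL e) le 𝓛e))
  ... | inj₂ (inj₂ 𝓕e) = 𝓛-cycle-in-I⇒¬𝓕-loop has𝓛 le e₁∉U 𝓕e

lemma3p2 : (G : Graph) (Q : QuasiBiased G) (U : VSet G)
  (LB LL : ESet G) →
  IsLoopsIn G Q (QuasiBiased.𝓑 Q) LB →
  IsLoopsIn G Q (QuasiBiased.𝓛 Q) LL →
  (¬ (∃[ C ] (C ⊆ inducedEdges G Q U × QuasiBiased.𝓛 Q C)) →
    Flat G Q (inducedEdges G Q U ∪ LB))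
  × ((∃[ C ] (C ⊆ inducedEdges G Q U × QuasiBiased.𝓛 Q C)) →
    Flat G Q ((inducedEdges G Q U ∪ LB) ∪ LL))
lemma3p2 G Q U LB LL loopsB loopsL = flat-I∪LB , flat-I∪LB∪LL
  where
  open QuasiBiased Q
  open InducedFlats G Q U

  classify-I∪LB : ∀ g → g ∈ I ∪ LB → g ∈ I ⊎ (isLoop G g × ¬ 𝓕 ⁅ g ⁆)
  classify-I∪LB g g∈I∪LB = Sum.map₂ (loops-outside-𝓕 loopsB 𝓑𝓕-disj) (x∈p∪q⁻ I LB g∈I∪LB)

  classify-I∪LB∪LL : ∀ g → g ∈ (I ∪ LB) ∪ LL → g ∈ I ⊎ (isLoop G g × ¬ 𝓕 ⁅ g ⁆)
  classify-I∪LB∪LL g g∈X =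
    [ classify-I∪LB g , inj₂ ∘ loops-outside-𝓕 loopsL 𝓛𝓕-disj ] (x∈p∪q⁻ (I ∪ LB) LL g∈X)

  flat-I∪LB : ¬ (∃[ C ] (C ⊆ I × 𝓛 C)) → Flat G Q (I ∪ LB)
  flat-I∪LB no𝓛 = flat-criterion (I ∪ LB) (p⊆p∪q LB) classify-I∪LB (I∪LB-loop-closed loopsB no𝓛)

  flat-I∪LB∪LL : ∃[ C ] (C ⊆ I × 𝓛 C) → Flat G Q ((I ∪ LB) ∪ LL)
  flat-I∪LB∪LL has𝓛 = flat-criterion ((I ∪ LB) ∪ LL) (λ g∈I → p⊆p∪q LL (p⊆p∪q LB g∈I))
    classify-I∪LB∪LL (I∪LB∪LL-loop-closed loopsB loopsL has𝓛)
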